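{- Let $(G,T)$ be a bipartite graft with color classes $A$ and $B$, and let $X\subseteq A$ be a maximal bipartitic extreme set. Then (i) $E_G[D_X, C_X]=\emptyset$; and (ii) every vertex of $C_X$ is a trivial vertex belonging to $B$.
   Context: All graphs are finite (parallel edges allowed). A graft is a pair $(G,T)$ with $T\subseteq V(G)$; a join is $F\subseteq E(G)$ such that each vertex is incident to an odd number of edges of $F$ iff it lies in $T$; a minimum join is one of minimum size. A bipartite graft is a graft with $G$ bipartite with given color classes. For $F\subseteq E(G)$ and a subgraph $Q$, $w_F(Q)=|E(Q)\setminus F|-|E(Q)\cap F|$; for $x,y\in V(G)$, $\lambda_F(x,y)$ is the minimum of $w_F(P)$ over paths $P$ between $x$ and $y$ (equal to $0$ when $x=y$). For a minimum join $F$ this value is independent of the choice of $F$. $E_G[Y,Z]$ denotes the set of edges joining $Y$ and $Z$. A set $X\subseteq V(G)$ is extreme if $\lambda_F(x,y)\ge 0$ for all $x,y\in X$, where $F$ is a minimum join. An extreme set is bipartitic if it is contained in one color class; a maximal bipartitic extreme set is one not properly contained in another bipartitic extreme set. For $X\subseteq V(G)$, $D_X:=\{y\in V(G)\setminus X : \min_{x\in X}\lambda_F(x,y)<0\}$ and $C_X:=V(G)\setminus X\setminus D_X$. An edge is allowed if it belongs to some minimum join; the factor-components are the connected components of the spanning subgraph of $G$ formed by the allowed edges; a vertex is trivial if its factor-component consists of that vertex alone. -}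

module Defs where

open import Data.Nat as ℕ using (ℕ; _%_)
open import Data.Integer as ℤ using (ℤ; +_; -[1+_]; 0ℤ)
open import Data.Bool using (Bool; true; false; if_then_else_)
open import Data.Fin using (Fin; _≟_)
open import Data.Fin.Subset using (Subset; _∈_; _∉_; _⊆_)
open import Data.Vec using (lookup)
open import Data.List using (List; []; _∷_; map; allFin)
open import Data.Nat.ListAction using (sum)
open import Data.List.Relation.Unary.Unique.Propositional using (Unique)
open import Data.Product using (_×_; _,_; Σ; ∃; ∃-syntax; proj₁; proj₂)
open import Data.Sum using (_⊎_)
open import Relation.Nullary using (¬_; does)
open import Relation.Binary.PropositionalEquality using (_≡_)

-- Finite multigraphs: vertices Fin n, edges Fin m, each edge has an
-- (unordered) pair of endpoints given by `ends`.  Parallel edges allowed.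

record Graph : Set where
  field
    n    : ℕ
    m    : ℕ
    ends : Fin m → Fin n × Fin n

open Graph public

-- Bipartite graph with given colour classes:
-- colour false = class A, colour true = class B; every edge joins the classes.
record BipartiteGraph : Set where
  field
    graph   : Graph
    colour  : Fin (n graph) → Bool
    proper  : ∀ e → ¬ (colour (proj₁ (ends graph e)) ≡ colour (proj₂ (ends graph e)))

open BipartiteGraph public

module _ (G : Graph) where

  V = Fin (n G)
  E = Fin (m G)

  Joins : E → V → V → Set
  Joins e x y = (ends G e ≡ (x , y)) ⊎ (ends G e ≡ (y , x))

  data Walk : V → V → Set where
    nil  : ∀ {x} → Walk x x
    cons : ∀ {x z y} (e : E) → Joins e x z → Walk z y → Walk x y

  walkVertices : ∀ {x y} → Walk x y → List V
  walkVertices {x} nil = x ∷ []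
  walkVertices {x} (cons e _ w) = x ∷ walkVertices w

  walkEdges : ∀ {x y} → Walk x y → List E
  walkEdges nil = []
  walkEdges (cons e _ w) = e ∷ walkEdges w

  IsPath : ∀ {x y} → Walk x y → Set
  IsPath w = Unique (walkVertices w)

  -- multiplicity of v as an endpoint of e (a loop counts twice)
  endMult : E → V → ℕ
  endMult e v = (if does (proj₁ (ends G e) ≟ v) then 1 else 0)
          ℕ.+ (if does (proj₂ (ends G e) ≟ v) then 1 else 0)

  degIn : Subset (m G) → V → ℕ
  degIn F v = sum (map (λ e → if lookup F e then endMult e v else 0) (allFin (m G)))

  size : Subset (m G) → ℕ
  size F = sum (map (λ e → if lookup F e then 1 else 0) (allFin (m G)))

  IsJoin : Subset (n G) → Subset (m G) → Set
  IsJoin T F = ∀ v → (degIn F v % 2 ≡ 1 → v ∈ T) × (v ∈ T → degIn F v % 2 ≡ 1)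

  IsMinJoin : Subset (n G) → Subset (m G) → Set
  IsMinJoin T F = IsJoin T F × (∀ F' → IsJoin T F' → size F ℕ.≤ size F')

  weight : Subset (m G) → ∀ {x y} → Walk x y → ℤ
  weight F w = Data.List.foldr (λ e acc → (if lookup F e then -[1+ 0 ] else + 1) ℤ.+ acc)
                               0ℤ (walkEdges w)

  -- λ_F(x,y) = k : k is the minimum of w_F(P) over paths P between x and y
  -- (when there is no path, no k satisfies this: λ_F(x,y) = +∞)
  LambdaIs : Subset (m G) → V → V → ℤ → Set
  LambdaIs F x y k =
    (Σ (Walk x y) λ P → IsPath P × weight F P ≡ k)
    × (∀ (P : Walk x y) → IsPath P → k ℤ.≤ weight F P)

  LambdaNonneg : Subset (m G) → V → V → Set
  LambdaNonneg F x y = ∀ k → LambdaIs F x y k → 0ℤ ℤ.≤ k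

  LambdaNeg : Subset (m G) → V → V → Set
  LambdaNeg F x y = ∃[ k ] (LambdaIs F x y k × k ℤ.< 0ℤ)

  Extreme : Subset (m G) → Subset (n G) → Set
  Extreme F X = ∀ x y → x ∈ X → y ∈ X → LambdaNonneg F x y

  InD : Subset (m G) → Subset (n G) → V → Set
  InD F X y = y ∉ X × ∃[ x ] (x ∈ X × LambdaNeg F x y)

  InC : Subset (m G) → Subset (n G) → V → Set
  InC F X y = y ∉ X × ¬ InD F X y

  Allowed : Subset (n G) → E → Set
  Allowed T e = ∃[ F ] (IsMinJoin T F × e ∈ F)

  data AllowedWalk (T : Subset (n G)) : V → V → Set where
    nil  : ∀ {x} → AllowedWalk T x x
    cons : ∀ {x z y} (e : E) → Allowed T e → Joins e x z → AllowedWalk T z y → AllowedWalk T x y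

  -- v is trivial: its factor-component is {v}
  Trivial : Subset (n G) → V → Set
  Trivial T v = ∀ u → AllowedWalk T v u → u ≡ v

module _ (H : BipartiteGraph) where

  private G = graph H

  InA InB : Fin (n G) → Set
  InA v = colour H v ≡ false
  InB v = colour H v ≡ true

  Bipartitic : Subset (n G) → Set
  Bipartitic X = (∀ v → v ∈ X → InA v) ⊎ (∀ v → v ∈ X → InB v)

  MaxBipartiticExtreme : Subset (m G) → Subset (n G) → Set
  MaxBipartiticExtreme F X =
    Bipartitic X × Extreme G F X ×
    (∀ Y → Bipartitic Y → Extreme G F Y → X ⊆ Y → Y ⊆ X)

{-# OPTIONS --safe #-}
module Submission where

-- C ⊆ B, since for y ∈ C ∩ A the set X ∪ {y} would be a larger bipartitic extreme set.
-- Let v ∈ C. A lightest path from X to a vertex u ∈ D ∩ A has even weight, hence weight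
-- ≤ −2; continuing it along an edge uv, or cutting it at v (cycles have nonnegative weight
-- with respect to a minimum join), would give a negative path from X to v. So D and C are
-- not adjacent, every neighbour of v lies in X, and v ∉ T. If v had an allowed edge vu,
-- some minimum join F' contains it together with a second edge vu'; toggling both gives a
-- join of T △ {u, u'} of size |F| − 2, and its symmetric difference with F contains a
-- u'–u path of weight ≤ −2 between two vertices of X, contradicting extremality.

open import Defs
open import Data.Nat as ℕ using (ℕ; zero; suc; _%_)
import Data.Nat.Properties as ℕP
open import Data.Integer as ℤ using (ℤ; +_; -[1+_]; 0ℤ; _+_; -_; _≤_; _<_)
import Data.Integer.Properties as ℤP
open import Data.Integer.Tactic.RingSolver using (solve-∀)
open import Data.Bool using (Bool; true; false; if_then_else_; not; _xor_)
open import Data.Bool.Properties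
  using ( not-involutive; not-distribˡ-xor; not-distribʳ-xor; not-¬; ¬-not
        ; xor-assoc; xor-comm; xor-same; xor-identityʳ; xor-inverseˡ)
open import Data.Fin using (Fin; zero; suc; _≟_)
open import Data.Fin.Properties using (pigeonhole; suc-injective)
open import Data.Fin.Subset using (Subset; _∈_; ⁅_⁆; _∪_)
open import Data.Fin.Subset.Properties using (x∈p∪q⁻; x∈⁅y⁆⇒x≡y; x∈⁅x⁆; p⊆p∪q; q⊆p∪q)
open import Data.Vec using (lookup; _[_]≔_)
open import Data.Vec.Properties using (lookup∘update; lookup∘update′; []=⇒lookup; lookup⇒[]=)
open import Data.List using (List; []; _∷_; map; allFin; tabulate; length)
open import Data.List.Properties using (map-tabulate)
open import Data.Nat.ListAction using (sum)
open import Data.List.Membership.Propositional using () renaming (_∈_ to _∈ˡ_)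
open import Data.List.Membership.Propositional.Properties using (∈-lookup)
open import Data.List.Relation.Unary.Any using (here; there)
open import Data.List.Relation.Unary.All as All using (All; []; _∷_)
open import Data.List.Relation.Unary.All.Properties using (++⁻ˡ; ++⁻ʳ; ¬Any⇒All¬)
open import Data.List.Relation.Unary.AllPairs using ([]; _∷_)
open import Data.List.Relation.Unary.Unique.Propositional using (Unique)
open import Data.Product using (_×_; _,_; proj₁; proj₂; ∃-syntax)
open import Data.Sum using (_⊎_; inj₁; inj₂; [_,_]′)
open import Data.Empty using (⊥; ⊥-elim)
open import Relation.Nullary using (¬_; does; yes; no; ¬¬-excluded-middle)
open import Relation.Binary.PropositionalEquality
open import Function using (_∘_)

isOdd : ℕ → Bool
isOdd zero = false
isOdd (suc n) = not (isOdd n)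

isOdd-+ : ∀ a b → isOdd (a ℕ.+ b) ≡ isOdd a xor isOdd b
isOdd-+ zero b = refl
isOdd-+ (suc a) b = trans (cong not (isOdd-+ a b)) (not-distribˡ-xor (isOdd a) (isOdd b))

bit : Bool → ℕ
bit b = if b then 1 else 0

bit≡1 : ∀ {b} → bit b ≡ 1 → b ≡ true
bit≡1 {true} _ = refl

isOdd-bit : ∀ b → isOdd (bit b) ≡ b
isOdd-bit true = refl
isOdd-bit false = refl

%2≡bit∘isOdd : ∀ n → n % 2 ≡ bit (isOdd n)
%2≡bit∘isOdd zero = refl
%2≡bit∘isOdd (suc zero) = refl
%2≡bit∘isOdd (suc (suc n)) rewrite not-involutive (isOdd n) = %2≡bit∘isOdd n

xor-cancel-middle : ∀ a b c → (a xor b) xor (b xor c) ≡ a xor c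
xor-cancel-middle a b c = begin
  (a xor b) xor (b xor c) ≡⟨ xor-assoc a b (b xor c) ⟩
  a xor (b xor (b xor c)) ≡⟨ cong (a xor_) (sym (xor-assoc b b c)) ⟩
  a xor ((b xor b) xor c) ≡⟨ cong (λ z → a xor (z xor c)) (xor-same b) ⟩
  a xor c                 ∎
  where open ≡-Reasoning

xor-swap-endpoint : ∀ x a b c → (x xor (a xor b)) xor (a xor c) ≡ x xor (c xor b)
xor-swap-endpoint x a b c = begin
  (x xor (a xor b)) xor (a xor c) ≡⟨ xor-assoc x (a xor b) (a xor c) ⟩
  x xor ((a xor b) xor (a xor c)) ≡⟨ cong (λ z → x xor (z xor (a xor c))) (xor-comm a b) ⟩
  x xor ((b xor a) xor (a xor c)) ≡⟨ cong (x xor_) (xor-cancel-middle b a c) ⟩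
  x xor (b xor c)                 ≡⟨ cong (x xor_) (xor-comm b c) ⟩
  x xor (c xor b)                 ∎
  where open ≡-Reasoning

xor-cancelʳ : ∀ a b → (a xor b) xor b ≡ a
xor-cancelʳ a b = trans (xor-assoc a b b) (trans (cong (a xor_) (xor-same b)) (xor-identityʳ a))

sumFin : ∀ {k} → (Fin k → ℕ) → ℕ
sumFin f = sum (tabulate f)

sum-map-allFin : ∀ {k} (f : Fin k → ℕ) → sum (map f (allFin k)) ≡ sumFin f
sum-map-allFin f = cong sum (map-tabulate (λ i → i) f)

sumFin-cong : ∀ {k} (f g : Fin k → ℕ) → (∀ i → f i ≡ g i) → sumFin f ≡ sumFin g
sumFin-cong {zero} f g f≗g = refl
sumFin-cong {suc k} f g f≗g = cong₂ ℕ._+_ (f≗g zero) (sumFin-cong (f ∘ suc) (g ∘ suc) (f≗g ∘ suc))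

sumFin-zero : ∀ k → sumFin {k} (λ _ → 0) ≡ 0
sumFin-zero zero = refl
sumFin-zero (suc k) = sumFin-zero k

sumFin-update : ∀ {k} (f g : Fin k → ℕ) (e : Fin k) → (∀ i → i ≢ e → f i ≡ g i) →
                sumFin f ℕ.+ g e ≡ sumFin g ℕ.+ f e
sumFin-update {suc k} f g zero f≗g rewrite sumFin-cong (f ∘ suc) (g ∘ suc) (λ i → f≗g (suc i) λ ()) =
  swap-ends (f zero) (g zero) (sumFin (g ∘ suc))
  where
  swap-ends : ∀ a b s → (a ℕ.+ s) ℕ.+ b ≡ (b ℕ.+ s) ℕ.+ a
  swap-ends a b s = trans (ℕP.+-comm (a ℕ.+ s) b) (trans (cong (b ℕ.+_) (ℕP.+-comm a s)) (sym (ℕP.+-assoc b s a)))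
sumFin-update {suc k} f g (suc e) f≗g = begin
  (f zero ℕ.+ sumFin (f ∘ suc)) ℕ.+ g (suc e) ≡⟨ ℕP.+-assoc (f zero) _ _ ⟩
  f zero ℕ.+ (sumFin (f ∘ suc) ℕ.+ g (suc e)) ≡⟨ cong₂ ℕ._+_ (f≗g zero λ ()) (sumFin-update (f ∘ suc) (g ∘ suc) e
                                                   (λ i i≢e → f≗g (suc i) (i≢e ∘ suc-injective))) ⟩
  g zero ℕ.+ (sumFin (g ∘ suc) ℕ.+ f (suc e)) ≡⟨ sym (ℕP.+-assoc (g zero) _ _) ⟩
  (g zero ℕ.+ sumFin (g ∘ suc)) ℕ.+ f (suc e) ∎
  where open ≡-Reasoning

sumFin-≢ : ∀ {k} (f g : Fin k → ℕ) → sumFin f ≢ sumFin g → ∃[ i ] f i ≢ g i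
sumFin-≢ {zero} f g ne = ⊥-elim (ne refl)
sumFin-≢ {suc k} f g ne with f zero ℕP.≟ g zero
... | no f0≢g0 = zero , f0≢g0
... | yes f0≡g0 with sumFin-≢ (f ∘ suc) (g ∘ suc) (ne ∘ cong₂ ℕ._+_ f0≡g0)
...   | i , fi≢gi = suc i , fi≢gi

+-cancelˡ-≤ : ∀ i {j k} → i + j ≤ i + k → j ≤ k
+-cancelˡ-≤ i {j} {k} le = subst₂ _≤_ (-i+[i+j]≡j j) (-i+[i+j]≡j k) (ℤP.+-monoʳ-≤ (- i) le)
  where
  -i+[i+j]≡j : ∀ j → - i + (i + j) ≡ j
  -i+[i+j]≡j j = trans (sym (ℤP.+-assoc (- i) i j)) (trans (cong (_+ j) (ℤP.+-inverseˡ i)) (ℤP.+-identityˡ j))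

Unique⇒length≤ : ∀ {k} (xs : List (Fin k)) → Unique xs → length xs ℕ.≤ k
Unique⇒length≤ {k} xs u with length xs ℕP.≤? k
... | yes ≤k = ≤k
... | no ≰k with pigeonhole (ℕP.≰⇒> ≰k) (Data.List.lookup xs)
...   | i , j , i<j , xsᵢ≡xsⱼ = ⊥-elim (distinct xs u i j i<j xsᵢ≡xsⱼ)
  where
  distinct : ∀ {k} (xs : List (Fin k)) → Unique xs → ∀ i j → i Data.Fin.< j →
             Data.List.lookup xs i ≢ Data.List.lookup xs j
  distinct (x ∷ xs) (x∉xs ∷ _) zero (suc j) _ x≡ = All.lookup x∉xs (∈-lookup j) x≡
  distinct (x ∷ xs) (_ ∷ u) (suc i) (suc j) (ℕ.s≤s i<j) = distinct xs u i j i<j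

module Toggling (G : Graph) where

  δ : V G → V G → Bool
  δ x v = does (x ≟ v)

  δ-refl : ∀ v → δ v v ≡ true
  δ-refl v with v ≟ v
  ... | yes _ = refl
  ... | no v≢v = ⊥-elim (v≢v refl)

  δ-≢ : ∀ {u v} → u ≢ v → δ u v ≡ false
  δ-≢ {u} {v} u≢v with u ≟ v
  ... | yes u≡v = ⊥-elim (u≢v u≡v)
  ... | no _ = refl

  toggle : Subset (m G) → E G → Subset (m G)
  toggle F e = F [ e ]≔ not (lookup F e)

  toggle-here : ∀ F e → lookup (toggle F e) e ≡ not (lookup F e)
  toggle-here F e = lookup∘update e F _

  toggle-there : ∀ F e {e'} → e' ≢ e → lookup (toggle F e) e' ≡ lookup F e'
  toggle-there F e e'≢e = lookup∘update′ e'≢e F _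

  -- degIn G F v and size G F are both of this form, definitionally.
  sumOver : Subset (m G) → (E G → ℕ) → ℕ
  sumOver F c = sum (map (λ e → if lookup F e then c e else 0) (allFin (m G)))

  sumOver≡sumFin : ∀ F c → sumOver F c ≡ sumFin (λ e → if lookup F e then c e else 0)
  sumOver≡sumFin F c = sum-map-allFin (λ e → if lookup F e then c e else 0)

  private
    sumOver-toggle : ∀ F e c → sumOver F c ℕ.+ (if lookup (toggle F e) e then c e else 0)
                               ≡ sumOver (toggle F e) c ℕ.+ (if lookup F e then c e else 0)
    sumOver-toggle F e c rewrite sumOver≡sumFin F c | sumOver≡sumFin (toggle F e) c =
      sumFin-update _ _ e (λ i i≢e → cong (λ b → if b then c i else 0) (sym (toggle-there F e i≢e)))

  sumOver-toggle-∈ : ∀ {F e} c → lookup F e ≡ true → sumOver F c ≡ sumOver (toggle F e) c ℕ.+ c e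
  sumOver-toggle-∈ {F} {e} c e∈F with sumOver-toggle F e c
  ... | eq rewrite toggle-here F e | e∈F = trans (sym (ℕP.+-identityʳ _)) eq

  sumOver-toggle-∉ : ∀ {F e} c → lookup F e ≡ false → sumOver (toggle F e) c ≡ sumOver F c ℕ.+ c e
  sumOver-toggle-∉ {F} {e} c e∉F with sumOver-toggle F e c
  ... | eq rewrite toggle-here F e | e∉F = trans (sym (ℕP.+-identityʳ _)) (sym eq)

  edgeWeight : Subset (m G) → E G → ℤ
  edgeWeight F e = if lookup F e then -[1+ 0 ] else + 1

  edgeWeight≤1 : ∀ F e → edgeWeight F e ≤ + 1
  edgeWeight≤1 F e with lookup F e
  ... | true = ℤ.-≤+
  ... | false = ℤP.≤-refl

  edgeWeight≥-1 : ∀ F e → -[1+ 0 ] ≤ edgeWeight F e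
  edgeWeight≥-1 F e with lookup F e
  ... | true = ℤP.≤-refl
  ... | false = ℤ.-≤+

  size-toggle : ∀ F e → + size G (toggle F e) ≡ + size G F + edgeWeight F e
  size-toggle F e = byMembership (lookup F e) refl
    where
    weight≡ : ∀ {b} → lookup F e ≡ b → edgeWeight F e ≡ (if b then -[1+ 0 ] else + 1)
    weight≡ = cong (λ b → if b then -[1+ 0 ] else + 1)
    byMembership : ∀ b → lookup F e ≡ b → + size G (toggle F e) ≡ + size G F + edgeWeight F e
    byMembership true e∈F = begin
      + size G (toggle F e)                          ≡⟨ cong (λ k → + k + -[1+ 0 ]) (ℕP.+-comm 1 _) ⟩
      + (size G (toggle F e) ℕ.+ 1) + -[1+ 0 ]      ≡⟨ cong (λ k → + k + -[1+ 0 ]) (sym (sumOver-toggle-∈ {F} {e} _ e∈F)) ⟩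
      + size G F + -[1+ 0 ]                        ≡⟨ cong (λ w → + size G F + w) (sym (weight≡ e∈F)) ⟩
      + size G F + edgeWeight F e                  ∎
      where open ≡-Reasoning
    byMembership false e∉F =
      trans (cong +_ (sumOver-toggle-∉ {F} {e} _ e∉F)) (cong (λ w → + size G F + w) (sym (weight≡ e∉F)))

  size-toggle-∈ : ∀ {F e} → lookup F e ≡ true → + size G (toggle F e) ≡ + size G F + -[1+ 0 ]
  size-toggle-∈ {F} {e} e∈F = trans (size-toggle F e) (cong (λ b → + size G F + (if b then -[1+ 0 ] else + 1)) e∈F)

  isOdd-endMult : ∀ {e x z} → Joins G e x z → ∀ v → isOdd (endMult G e v) ≡ δ x v xor δ z v
  isOdd-endMult {e} j v =
    trans (isOdd-+ (bit (δ p v)) (bit (δ q v))) (trans (cong₂ _xor_ (isOdd-bit (δ p v)) (isOdd-bit (δ q v))) (oriented j))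
    where
    p = proj₁ (ends G e)
    q = proj₂ (ends G e)
    oriented : ∀ {x z} → Joins G e x z → δ p v xor δ q v ≡ δ x v xor δ z v
    oriented (inj₁ refl) = refl
    oriented {x} {z} (inj₂ refl) = xor-comm (δ z v) (δ x v)

  isOdd-degIn-toggle : ∀ F e v → isOdd (degIn G (toggle F e) v) ≡ isOdd (degIn G F v) xor isOdd (endMult G e v)
  isOdd-degIn-toggle F e v = byMembership (lookup F e) refl
    where
    c = endMult G e v
    byMembership : ∀ b → lookup F e ≡ b → isOdd (degIn G (toggle F e) v) ≡ isOdd (degIn G F v) xor isOdd c
    byMembership true e∈F = sym (begin
      isOdd (degIn G F v) xor isOdd c
        ≡⟨ cong (λ k → isOdd k xor isOdd c) (sumOver-toggle-∈ {F} {e} (λ e → endMult G e v) e∈F) ⟩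
      isOdd (degIn G (toggle F e) v ℕ.+ c) xor isOdd c          ≡⟨ cong (_xor isOdd c) (isOdd-+ (degIn G (toggle F e) v) c) ⟩
      (isOdd (degIn G (toggle F e) v) xor isOdd c) xor isOdd c  ≡⟨ xor-cancelʳ _ _ ⟩
      isOdd (degIn G (toggle F e) v)                            ∎)
      where open ≡-Reasoning
    byMembership false e∉F =
      trans (cong isOdd (sumOver-toggle-∉ {F} {e} (λ e → endMult G e v) e∉F)) (isOdd-+ (degIn G F v) c)

  -- IsJoin in parity form, with the terminal set given by its indicator function, so that
  -- symmetric differences of terminal sets become pointwise xor.
  IsJoinOf : (V G → Bool) → Subset (m G) → Set
  IsJoinOf t F = ∀ v → isOdd (degIn G F v) ≡ t v

  IsJoinOf-cong : ∀ {t t' F} → (∀ v → t v ≡ t' v) → IsJoinOf t F → IsJoinOf t' F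
  IsJoinOf-cong t≗t' j v = trans (j v) (t≗t' v)

  IsJoin⇒IsJoinOf : ∀ {T F} → IsJoin G T F → IsJoinOf (lookup T) F
  IsJoin⇒IsJoinOf {T} {F} j v with lookup T v in v∈?T
  ... | true = bit≡1 (trans (sym (%2≡bit∘isOdd (degIn G F v))) (proj₂ (j v) (lookup⇒[]= v T v∈?T)))
  ... | false = ¬-not λ odd → not-¬ refl (trans (sym v∈?T)
                  ([]=⇒lookup (proj₁ (j v) (trans (%2≡bit∘isOdd (degIn G F v)) (cong bit odd)))))

  IsJoinOf⇒IsJoin : ∀ {T F} → IsJoinOf (lookup T) F → IsJoin G T F
  IsJoinOf⇒IsJoin {T} {F} j v =
    (λ odd → lookup⇒[]= v T (trans (sym (j v)) (bit≡1 (trans (sym (%2≡bit∘isOdd (degIn G F v))) odd)))) ,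
    (λ v∈T → trans (%2≡bit∘isOdd (degIn G F v)) (cong bit (trans (j v) ([]=⇒lookup v∈T))))

  toggle-IsJoinOf : ∀ {t F e x z} → Joins G e x z → IsJoinOf t F →
                    IsJoinOf (λ v → t v xor (δ x v xor δ z v)) (toggle F e)
  toggle-IsJoinOf {t} {F} {e} j jF v = trans (isOdd-degIn-toggle F e v) (cong₂ _xor_ (jF v) (isOdd-endMult j v))

  toggleAlong : ∀ {x y} → Subset (m G) → Walk G x y → Subset (m G)
  toggleAlong F nil = F
  toggleAlong F (cons e _ w) = toggleAlong (toggle F e) w

  toggleAlong-IsJoinOf : ∀ {t F x y} → IsJoinOf t F → (w : Walk G x y) →
                         IsJoinOf (λ v → t v xor (δ x v xor δ y v)) (toggleAlong F w)
  toggleAlong-IsJoinOf {t} {F} {x = x} jF nil =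
    IsJoinOf-cong {F = F} (λ v → sym (trans (cong (t v xor_) (xor-same (δ x v))) (xor-identityʳ (t v)))) jF
  toggleAlong-IsJoinOf {t} {F} {x = x} {y} jF (cons {z = z} e j w) =
    IsJoinOf-cong {F = toggleAlong (toggle F e) w}
      (λ v → trans (xor-assoc (t v) _ _) (cong (t v xor_) (xor-cancel-middle (δ x v) (δ z v) (δ y v))))
      (toggleAlong-IsJoinOf {F = toggle F e} (toggle-IsJoinOf {F = F} j jF) w)

  weight-cong : ∀ F F' {x y} (w : Walk G x y) → All (λ e → lookup F e ≡ lookup F' e) (walkEdges G w) →
                weight G F w ≡ weight G F' w
  weight-cong F F' nil _ = refl
  weight-cong F F' (cons e _ w) (Fe≡F'e ∷ agree) =
    cong₂ _+_ (cong (λ b → if b then -[1+ 0 ] else + 1) Fe≡F'e) (weight-cong F F' w agree)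

  size-toggleAlong : ∀ F {x y} (w : Walk G x y) → Unique (walkEdges G w) →
                     + size G (toggleAlong F w) ≡ + size G F + weight G F w
  size-toggleAlong F nil _ = sym (ℤP.+-identityʳ _)
  size-toggleAlong F (cons e _ w) (e∉w ∷ distinct) = begin
    + size G (toggleAlong (toggle F e) w)                   ≡⟨ size-toggleAlong (toggle F e) w distinct ⟩
    + size G (toggle F e) + weight G (toggle F e) w
      ≡⟨ cong₂ _+_ (size-toggle F e) (weight-cong (toggle F e) F w (All.map (λ e≢e' → toggle-there F e (e≢e' ∘ sym)) e∉w)) ⟩
    (+ size G F + edgeWeight F e) + weight G F w            ≡⟨ ℤP.+-assoc (+ size G F) (edgeWeight F e) _ ⟩
    + size G F + (edgeWeight F e + weight G F w)            ∎
    where open ≡-Reasoning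

module Paths (G : Graph) where

  Joins-sym : ∀ {e a b} → Joins G e a b → Joins G e b a
  Joins-sym (inj₁ p) = inj₂ p
  Joins-sym (inj₂ p) = inj₁ p

  Joins-endpoint : ∀ {e a b x z} → Joins G e a b → Joins G e x z → a ≡ x ⊎ a ≡ z
  Joins-endpoint (inj₁ p) (inj₁ q) = inj₁ (cong proj₁ (trans (sym p) q))
  Joins-endpoint (inj₁ p) (inj₂ q) = inj₂ (cong proj₁ (trans (sym p) q))
  Joins-endpoint (inj₂ p) (inj₁ q) = inj₂ (cong proj₂ (trans (sym p) q))
  Joins-endpoint (inj₂ p) (inj₂ q) = inj₁ (cong proj₂ (trans (sym p) q))

  head∈walk : ∀ {x y} (w : Walk G x y) → x ∈ˡ walkVertices G w
  head∈walk nil = here refl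
  head∈walk (cons e j w) = here refl

  last∈walk : ∀ {x y} (w : Walk G x y) → y ∈ˡ walkVertices G w
  last∈walk nil = here refl
  last∈walk (cons e j w) = there (last∈walk w)

  endpoint∈walk : ∀ {a b x y} (w : Walk G x y) {e} → e ∈ˡ walkEdges G w → Joins G e a b → a ∈ˡ walkVertices G w
  endpoint∈walk (cons e' j w) (here refl) jab with Joins-endpoint jab j
  ... | inj₁ refl = here refl
  ... | inj₂ refl = there (head∈walk w)
  endpoint∈walk (cons e' j w) (there e∈w) jab = there (endpoint∈walk w e∈w jab)

  path-edges-unique : ∀ {x y} (w : Walk G x y) → IsPath G w → Unique (walkEdges G w)
  path-edges-unique nil _ = []
  path-edges-unique (cons e j w) (x∉w ∷ p) =
    All.tabulate (λ e'∈w e≡e' → All.lookup x∉w (endpoint∈walk w (subst (_∈ˡ walkEdges G w) (sym e≡e') e'∈w) j) refl)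
    ∷ path-edges-unique w p

  closedPath-edges : ∀ {x} (w : Walk G x x) → IsPath G w → walkEdges G w ≡ []
  closedPath-edges nil _ = refl
  closedPath-edges (cons e j w) (x∉w ∷ _) = ⊥-elim (All.lookup x∉w (last∈walk w) refl)

  path-through-closing-edge : ∀ {s t e} (Q : Walk G s t) → IsPath G Q → Joins G e t s →
                              e ∈ˡ walkEdges G Q → walkEdges G Q ≡ e ∷ []
  path-through-closing-edge (cons e' j Q) (s∉Q ∷ p) jts (here refl) with Joins-endpoint (Joins-sym j) (Joins-sym jts)
  ... | inj₂ refl = cong (e' ∷_) (closedPath-edges Q p)
  ... | inj₁ refl = ⊥-elim (All.lookup s∉Q (head∈walk Q) refl)
  path-through-closing-edge (cons e' j Q) (s∉Q ∷ _) jts (there e∈Q) =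
    ⊥-elim (All.lookup s∉Q (endpoint∈walk Q e∈Q (Joins-sym jts)) refl)

  open Toggling G using (edgeWeight; edgeWeight≥-1)

  weight-single : ∀ F {x y e} (Q : Walk G x y) → walkEdges G Q ≡ e ∷ [] → weight G F Q ≡ edgeWeight F e
  weight-single F {e = e} Q edges≡ =
    trans (cong (Data.List.foldr (λ e w → edgeWeight F e + w) 0ℤ) edges≡) (ℤP.+-identityʳ (edgeWeight F e))

  tail-vertices : ∀ {x y} → Walk G x y → List (V G)
  tail-vertices nil = []
  tail-vertices (cons e j w) = walkVertices G w

  walkVertices-head : ∀ {x y} (w : Walk G x y) → walkVertices G w ≡ x ∷ tail-vertices w
  walkVertices-head nil = refl
  walkVertices-head (cons e j w) = refl

  reverseOnto : ∀ {a y z} → Walk G a y → Walk G a z → Walk G y z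
  reverseOnto nil acc = acc
  reverseOnto (cons e j w) acc = reverseOnto w (cons e (Joins-sym j) acc)

  reverse : ∀ {a y} → Walk G a y → Walk G y a
  reverse w = reverseOnto w nil

  weight-reverseOnto : ∀ F {a y z} (w : Walk G a y) (acc : Walk G a z) →
                       weight G F (reverseOnto w acc) ≡ weight G F w + weight G F acc
  weight-reverseOnto F nil acc = sym (ℤP.+-identityˡ _)
  weight-reverseOnto F (cons e j w) acc = begin
    weight G F (reverseOnto w (cons e (Joins-sym j) acc))      ≡⟨ weight-reverseOnto F w _ ⟩
    weight G F w + (edgeWeight F e + weight G F acc)           ≡⟨ sym (ℤP.+-assoc (weight G F w) _ _) ⟩
    (weight G F w + edgeWeight F e) + weight G F acc           ≡⟨ cong (_+ weight G F acc) (ℤP.+-comm (weight G F w) _) ⟩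
    (edgeWeight F e + weight G F w) + weight G F acc           ∎
    where open ≡-Reasoning

  weight-reverse : ∀ F {a y} (w : Walk G a y) → weight G F (reverse w) ≡ weight G F w
  weight-reverse F w = trans (weight-reverseOnto F w nil) (ℤP.+-identityʳ _)

  walkVertices-reverseOnto : ∀ {a y z} (w : Walk G a y) (acc : Walk G a z) →
                             walkVertices G (reverseOnto w acc) ≡ Data.List.reverseAcc (walkVertices G acc) (tail-vertices w)
  walkVertices-reverseOnto nil acc = refl
  walkVertices-reverseOnto (cons e j w) acc rewrite walkVertices-head w =
    walkVertices-reverseOnto w (cons e (Joins-sym j) acc)

  Unique-reverseAcc : ∀ (xs ys : List (V G)) → Unique xs → Unique ys →
                      (∀ {z} → z ∈ˡ xs → z ∈ˡ ys → ⊥) → Unique (Data.List.reverseAcc xs ys)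
  Unique-reverseAcc xs [] uxs _ _ = uxs
  Unique-reverseAcc xs (y ∷ ys) uxs (y∉ys ∷ uys) disjoint =
    Unique-reverseAcc (y ∷ xs) ys (y∉xs ∷ uxs) uys
      λ { (here refl) z∈ys → All.lookup y∉ys z∈ys refl ; (there z∈xs) z∈ys → disjoint z∈xs (there z∈ys) }
    where
    y∉xs = All.tabulate (λ z∈xs z≡y → disjoint (subst (_∈ˡ xs) (sym z≡y) z∈xs) (here refl))

  reverse-IsPath : ∀ {a y} (w : Walk G a y) → IsPath G w → IsPath G (reverse w)
  reverse-IsPath {a} w p rewrite walkVertices-reverseOnto w nil with subst Unique (walkVertices-head w) p
  ... | a∉w ∷ uw = Unique-reverseAcc (a ∷ []) (tail-vertices w) ([] ∷ []) uw
                     λ { (here refl) a∈w → All.lookup a∉w a∈w refl }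

  LambdaIs-sym : ∀ F {x y k} → LambdaIs G F x y k → LambdaIs G F y x k
  LambdaIs-sym F ((P , p , wP≡k) , minimal) =
    (reverse P , reverse-IsPath P p , trans (weight-reverse F P) wP≡k) ,
    λ Q q → ℤP.≤-trans (minimal (reverse Q) (reverse-IsPath Q q)) (ℤP.≤-reflexive (weight-reverse F Q))

  record Split (F : Subset (m G)) {u x : V G} (P : Walk G u x) (v : V G) : Set where
    field
      before : Walk G u v
      after : Walk G v x
      before-IsPath : IsPath G before
      after-IsPath : IsPath G after
      weight-split : weight G F P ≡ weight G F before + weight G F after
      edges-split : walkEdges G P ≡ walkEdges G before Data.List.++ walkEdges G after
      before-⊆ : ∀ {z} → z ∈ˡ walkVertices G before → z ∈ˡ walkVertices G P

  split : ∀ F {u x v} (P : Walk G u x) → IsPath G P → v ∈ˡ walkVertices G P → Split F P v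
  split F nil p (here refl) =
    record { before = nil ; after = nil ; before-IsPath = [] ∷ [] ; after-IsPath = [] ∷ []
           ; weight-split = refl ; edges-split = refl ; before-⊆ = λ z∈ → z∈ }
  split F (cons e j P) p (here refl) =
    record { before = nil ; after = cons e j P ; before-IsPath = [] ∷ [] ; after-IsPath = p
           ; weight-split = sym (ℤP.+-identityˡ _) ; edges-split = refl ; before-⊆ = λ { (here refl) → here refl } }
  split F (cons e j P) (u∉P ∷ p) (there v∈P) =
    record { before = cons e j S.before ; after = S.after
           ; before-IsPath = All.tabulate (λ z∈ → All.lookup u∉P (S.before-⊆ z∈)) ∷ S.before-IsPath
           ; after-IsPath = S.after-IsPath
           ; weight-split = trans (cong (λ w → edgeWeight F e + w) S.weight-split) (sym (ℤP.+-assoc (edgeWeight F e) _ _))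
           ; edges-split = cong (e ∷_) S.edges-split
           ; before-⊆ = λ { (here refl) → here refl ; (there z∈) → there (S.before-⊆ z∈) } }
    where module S = Split (split F P p v∈P)

  weight+length-nonneg : ∀ F {x y} (w : Walk G x y) → 0ℤ ≤ weight G F w + + length (walkEdges G w)
  weight+length-nonneg F nil = ℤP.≤-refl
  weight+length-nonneg F (cons e j w) =
    subst (0ℤ ≤_) (regroup (edgeWeight F e) (weight G F w) (+ length (walkEdges G w)))
      (ℤP.+-mono-≤ (ℤP.+-monoˡ-≤ (+ 1) (edgeWeight≥-1 F e)) (weight+length-nonneg F w))
    where
    regroup : ∀ a b c → (a + + 1) + (b + c) ≡ (a + b) + (+ 1 + c)
    regroup = solve-∀

  length-walkVertices : ∀ {x y} (w : Walk G x y) → length (walkVertices G w) ≡ suc (length (walkEdges G w))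
  length-walkVertices nil = refl
  length-walkVertices (cons e j w) = cong suc (length-walkVertices w)

  path-weight-bound : ∀ F {x y} (P : Walk G x y) → IsPath G P → 0ℤ ≤ weight G F P + + n G
  path-weight-bound F P p = ℤP.≤-trans (weight+length-nonneg F P) (ℤP.+-monoʳ-≤ (weight G F P) (ℤ.+≤+ length≤n))
    where
    length≤n : length (walkEdges G P) ℕ.≤ n G
    length≤n = ℕP.<⇒≤ (subst (ℕ._≤ n G) (length-walkVertices P) (Unique⇒length≤ (walkVertices G P) p))

  -- λ is a minimum over finitely many paths; it is reached by descending
  -- through strictly lighter paths, which path-weight-bound makes finite.
  ¬¬LambdaIs-≤ : ∀ F {x y} (P : Walk G x y) → IsPath G P → ¬ ¬ (∃[ k ] (LambdaIs G F x y k × k ≤ weight G F P))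
  ¬¬LambdaIs-≤ F {x} {y} P p = descend ℤ.∣ weight G F P + + n G ∣ P p
                                  (ℤP.≤-reflexive (sym (ℤP.0≤i⇒+∣i∣≡i (path-weight-bound F P p))))
    where
    Below : Walk G x y → Set
    Below P = ∃[ k ] (LambdaIs G F x y k × k ≤ weight G F P)

    descend : ∀ N (P : Walk G x y) → IsPath G P → weight G F P + + n G ≤ + N → ¬ ¬ Below P
    lighter : ∀ N {P : Walk G x y} → weight G F P + + n G ≤ + N → ¬ Below P →
              (Q : Walk G x y) → IsPath G Q → weight G F Q < weight G F P → ⊥

    descend N P p bound noMin = ¬¬-excluded-middle λ where
      (no ∄lighter) →
        noMin (weight G F P , ((P , p , refl) , λ Q q → ℤP.≮⇒≥ λ wQ<wP → ∄lighter (Q , q , wQ<wP)) , ℤP.≤-refl)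
      (yes (Q , q , wQ<wP)) → lighter N {P} bound noMin Q q wQ<wP

    lighter zero bound noMin Q q wQ<wP =
      ℤP.<⇒≱ (ℤP.<-≤-trans (ℤP.+-monoˡ-< (+ n G) wQ<wP) bound) (path-weight-bound F Q q)
    lighter (suc N) bound noMin Q q wQ<wP =
      descend N Q q (ℤP.i<j⇒i≤pred[j] (ℤP.<-≤-trans (ℤP.+-monoˡ-< (+ n G) wQ<wP) bound))
        λ { (k , λk , k≤wQ) → noMin (k , λk , ℤP.≤-trans k≤wQ (ℤP.<⇒≤ wQ<wP)) }

module Incidence (G : Graph) where
  open Toggling G

  endMult≢0⇒Joins : ∀ e a → endMult G e a ≢ 0 → ∃[ c ] Joins G e a c
  endMult≢0⇒Joins e a ≢0 with proj₁ (ends G e) ≟ a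
  ... | yes p≡a = proj₂ (ends G e) , inj₁ (cong (_, proj₂ (ends G e)) p≡a)
  ... | no _ with proj₂ (ends G e) ≟ a
  ...   | yes q≡a = proj₁ (ends G e) , inj₂ (cong (proj₁ (ends G e) ,_) q≡a)
  ...   | no _ = ⊥-elim (≢0 refl)

  sumOver-≢ : ∀ F K c → sumOver F c ≢ sumOver K c → ∃[ e ] (lookup F e ≢ lookup K e × c e ≢ 0)
  sumOver-≢ F K c ne
    with sumFin-≢ _ _ (λ eq → ne (trans (sumOver≡sumFin F c) (trans eq (sym (sumOver≡sumFin K c)))))
  ... | e , terms≢ =
    e , (λ Fe≡Ke → terms≢ (cong (λ b → if b then c e else 0) Fe≡Ke)) , c≢0 (lookup F e) (lookup K e) terms≢
    where
    c≢0 : ∀ b b' → (if b then c e else 0) ≢ (if b' then c e else 0) → c e ≢ 0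
    c≢0 true  true  ne _ = ne refl
    c≢0 true  false ne c≡0 = ne c≡0
    c≢0 false true  ne c≡0 = ne (sym c≡0)
    c≢0 false false ne _ = ne refl

  sumOver-≢0 : ∀ F c → sumOver F c ≢ 0 → ∃[ e ] (lookup F e ≡ true × c e ≢ 0)
  sumOver-≢0 F c ≢0
    with sumFin-≢ _ (λ _ → 0) (λ eq → ≢0 (trans (sumOver≡sumFin F c) (trans eq (sumFin-zero (m G)))))
  ... | e , term≢0 = e , in-and-nonzero (lookup F e) term≢0
    where
    in-and-nonzero : ∀ b → (if b then c e else 0) ≢ 0 → b ≡ true × c e ≢ 0
    in-and-nonzero true c≢0 = refl , c≢0
    in-and-nonzero false 0≢0 = ⊥-elim (0≢0 refl)

  odd-degree-edge : ∀ F v → isOdd (degIn G F v) ≡ true → ∃[ e ] ∃[ u ] (lookup F e ≡ true × Joins G e v u)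
  odd-degree-edge F v odd
    with sumOver-≢0 F (λ e → endMult G e v) (λ deg≡0 → not-¬ refl (trans (sym (cong isOdd deg≡0)) odd))
  ... | e , e∈F , ≢0 = e , proj₁ (endMult≢0⇒Joins e v ≢0) , e∈F , proj₂ (endMult≢0⇒Joins e v ≢0)

  differing-edge : ∀ {s F K a b} → IsJoinOf s F → IsJoinOf (λ v → s v xor (δ a v xor δ b v)) K → a ≢ b →
                   ∃[ e ] ∃[ c ] (Joins G e a c × lookup F e ≢ lookup K e)
  differing-edge {s} {F} {K} {a} {b} jF jK a≢b with sumOver-≢ F K (λ e → endMult G e a) degrees≢
    where
    degrees≢ : degIn G F a ≢ degIn G K a
    degrees≢ deg≡ = not-¬ refl (begin
      s a                              ≡⟨ sym (jF a) ⟩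
      isOdd (degIn G F a)              ≡⟨ cong isOdd deg≡ ⟩
      isOdd (degIn G K a)              ≡⟨ jK a ⟩
      s a xor (δ a a xor δ b a)        ≡⟨ cong₂ (λ p q → s a xor (p xor q)) (δ-refl a) (δ-≢ (a≢b ∘ sym)) ⟩
      s a xor true                     ≡⟨ xor-comm (s a) true ⟩
      not (s a)                        ∎)
      where open ≡-Reasoning
  ... | e , Fe≢Ke , ≢0 = e , proj₁ (endMult≢0⇒Joins e a ≢0) , proj₂ (endMult≢0⇒Joins e a ≢0) , Fe≢Ke

module MinimumJoin (G : Graph) {T : Subset (n G)} {F : Subset (m G)} (minF : IsMinJoin G T F) where
  open Toggling G
  open Paths G
  open Incidence G
  open import Data.List.Membership.DecPropositional (_≟_ {n G}) using (_∈?_)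
  open import Data.List.Membership.DecPropositional (_≟_ {m G}) using () renaming (_∈?_ to _∈ᴱ?_)

  t : V G → Bool
  t = lookup T

  F-IsJoinOf : IsJoinOf t F
  F-IsJoinOf = IsJoin⇒IsJoinOf {T} {F} (proj₁ minF)

  size-minimal : ∀ {K} → IsJoinOf t K → size G F ℕ.≤ size G K
  size-minimal {K} jK = proj₂ minF K (IsJoinOf⇒IsJoin {T} {K} jK)

  closedWalk-weight-nonneg : ∀ {x} (w : Walk G x x) → Unique (walkEdges G w) → 0ℤ ≤ weight G F w
  closedWalk-weight-nonneg {x} w distinct = +-cancelˡ-≤ (+ size G F) (begin
    + size G F + 0ℤ                  ≡⟨ ℤP.+-identityʳ _ ⟩
    + size G F                       ≤⟨ ℤ.+≤+ (size-minimal {toggleAlong F w} toggled-IsJoinOf) ⟩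
    + size G (toggleAlong F w)       ≡⟨ size-toggleAlong F w distinct ⟩
    + size G F + weight G F w        ∎)
    where
    open ℤP.≤-Reasoning
    toggled-IsJoinOf : IsJoinOf t (toggleAlong F w)
    toggled-IsJoinOf = IsJoinOf-cong {F = toggleAlong F w}
      (λ v → trans (cong (t v xor_) (xor-same (δ x v))) (xor-identityʳ (t v)))
      (toggleAlong-IsJoinOf {F = F} F-IsJoinOf w)

  distance : Subset (m G) → ℕ
  distance K = sumFin (λ e → bit (lookup F e xor lookup K e))

  distance-toggle : ∀ K e → lookup F e ≢ lookup K e → distance K ≡ suc (distance (toggle K e))
  distance-toggle K e Fe≢Ke = begin
    distance K                                  ≡⟨ sym (ℕP.+-identityʳ _) ⟩
    distance K ℕ.+ 0                            ≡⟨ cong (λ b → distance K ℕ.+ bit b) (sym after) ⟩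
    distance K ℕ.+ bit (lookup F e xor lookup (toggle K e) e)
      ≡⟨ sumFin-update _ _ e (λ i i≢e → cong (λ b → bit (lookup F i xor b)) (sym (toggle-there K e i≢e))) ⟩
    distance (toggle K e) ℕ.+ bit (lookup F e xor lookup K e)
                                                ≡⟨ cong (λ b → distance (toggle K e) ℕ.+ bit b) before ⟩
    distance (toggle K e) ℕ.+ 1                 ≡⟨ ℕP.+-comm _ 1 ⟩
    suc (distance (toggle K e))                 ∎
    where
    open ≡-Reasoning
    before : lookup F e xor lookup K e ≡ true
    before = trans (cong (_xor lookup K e) (¬-not Fe≢Ke)) (xor-inverseˡ (lookup K e))
    after : lookup F e xor lookup (toggle K e) e ≡ false
    after = trans (cong (lookup F e xor_) (toggle-here K e))
              (trans (sym (not-distribʳ-xor (lookup F e) (lookup K e))) (cong not before))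

  size-toggle-differing : ∀ {K e X} → lookup F e ≢ lookup K e → X ≤ + size G (toggle K e) →
                          edgeWeight F e + X ≤ + size G K
  size-toggle-differing {K} {e} {X} Fe≢Ke X≤ = begin
    edgeWeight F e + X                                  ≤⟨ ℤP.+-monoʳ-≤ (edgeWeight F e) X≤ ⟩
    edgeWeight F e + + size G (toggle K e)              ≡⟨ cong (λ w → edgeWeight F e + w) (size-toggle K e) ⟩
    edgeWeight F e + (+ size G K + edgeWeight K e)      ≡⟨ swap (edgeWeight F e) (+ size G K) (edgeWeight K e) ⟩
    + size G K + (edgeWeight F e + edgeWeight K e)      ≡⟨ cong (λ w → + size G K + w) (opposite _ _ Fe≢Ke) ⟩
    + size G K + 0ℤ                                     ≡⟨ ℤP.+-identityʳ _ ⟩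
    + size G K                                          ∎
    where
    open ℤP.≤-Reasoning
    swap : ∀ a b c → a + (b + c) ≡ b + (a + c)
    swap = solve-∀
    opposite : ∀ b b' → b ≢ b' → (if b then -[1+ 0 ] else + 1) + (if b' then -[1+ 0 ] else + 1) ≡ 0ℤ
    opposite true true b≢b' = ⊥-elim (b≢b' refl)
    opposite true false _ = refl
    opposite false true _ = refl
    opposite false false b≢b' = ⊥-elim (b≢b' refl)

  JoinWith : V G → V G → Subset (m G) → Set
  JoinWith a b K = IsJoinOf (λ v → t v xor (δ a v xor δ b v)) K

  JoinWith-same : ∀ {a F} → JoinWith a a F → IsJoinOf t F
  JoinWith-same {a} {F} = IsJoinOf-cong {F = F} λ v → trans (cong (t v xor_) (xor-same (δ a v))) (xor-identityʳ (t v))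

  record SymDiffPath (a b : V G) (K : Subset (m G)) : Set where
    field
      path : Walk G a b
      isPath : IsPath G path
      differs : All (λ e → lookup F e ≢ lookup K e) (walkEdges G path)
      bound : weight G F path + + size G F ≤ + size G K

  module _ {a c b K e} (jac : Joins G e a c) (Fe≢Ke : lookup F e ≢ lookup K e) (Q : SymDiffPath c b (toggle K e)) where
    open SymDiffPath Q

    private
      Fe≡K'e : lookup F e ≡ lookup (toggle K e) e
      Fe≡K'e = trans (¬-not Fe≢Ke) (sym (toggle-here K e))

      e∉ : ∀ {es} → All (λ e' → lookup F e' ≢ lookup (toggle K e) e') es → All (e ≢_) es
      e∉ = All.map λ differs e≡e' → differs (subst (λ x → lookup F x ≡ lookup (toggle K e) x) e≡e' Fe≡K'e)

      differs-K : ∀ {es} → All (λ e' → lookup F e' ≢ lookup (toggle K e) e') es →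
                  All (λ e' → lookup F e' ≢ lookup K e') es
      differs-K ds =
        All.zipWith (λ (differs , e≢e') → subst (lookup F _ ≢_) (toggle-there K e (e≢e' ∘ sym)) differs) (ds , e∉ ds)

    SymDiffPath-extend : All (a ≢_) (walkVertices G path) → SymDiffPath a b K
    SymDiffPath-extend a∉Q = record
      { path = cons e jac path
      ; isPath = a∉Q ∷ isPath
      ; differs = Fe≢Ke ∷ differs-K differs
      ; bound = subst (_≤ + size G K) (sym (ℤP.+-assoc (edgeWeight F e) (weight G F path) _))
                  (size-toggle-differing {K} {e} Fe≢Ke bound) }

    SymDiffPath-shortcut : a ∈ˡ walkVertices G path → SymDiffPath a b K
    SymDiffPath-shortcut a∈Q = record
      { path = S.after
      ; isPath = S.after-IsPath
      ; differs = differs-K (++⁻ʳ (walkEdges G S.before) differs-split)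
      ; bound = begin
          weight G F S.after + + size G F
            ≡⟨ sym (ℤP.+-identityˡ _) ⟩
          0ℤ + (weight G F S.after + + size G F)
            ≤⟨ ℤP.+-monoˡ-≤ (weight G F S.after + + size G F) cycle-nonneg ⟩
          (edgeWeight F e + weight G F S.before) + (weight G F S.after + + size G F)
            ≡⟨ regroup (edgeWeight F e) (weight G F S.before) (weight G F S.after) (+ size G F) ⟩
          edgeWeight F e + ((weight G F S.before + weight G F S.after) + + size G F)
            ≡⟨ cong (λ w → edgeWeight F e + (w + + size G F)) (sym S.weight-split) ⟩
          edgeWeight F e + (weight G F path + + size G F)
            ≤⟨ size-toggle-differing {K} {e} Fe≢Ke bound ⟩
          + size G K ∎ }
      where
      open ℤP.≤-Reasoning
      module S = Split (split F path isPath a∈Q)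
      differs-split = subst (All (λ e' → lookup F e' ≢ lookup (toggle K e) e')) S.edges-split differs
      cycle-nonneg : 0ℤ ≤ edgeWeight F e + weight G F S.before
      cycle-nonneg = closedWalk-weight-nonneg (cons e jac S.before)
        (e∉ (++⁻ˡ (walkEdges G S.before) differs-split) ∷ path-edges-unique S.before S.before-IsPath)
      regroup : ∀ a b c x → (a + b) + (c + x) ≡ a + ((b + c) + x)
      regroup = solve-∀

  SymDiffPath-nil : ∀ {b K} → IsJoinOf t K → SymDiffPath b b K
  SymDiffPath-nil {K = K} jK = record
    { path = nil ; isPath = [] ∷ [] ; differs = []
    ; bound = ℤP.≤-trans (ℤP.≤-reflexive (ℤP.+-identityˡ _)) (ℤ.+≤+ (size-minimal {K} jK)) }

  -- Leave a along an edge of F △ K, recurse on the smaller symmetric difference, and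
  -- shortcut if the path found returns to a.
  symDiffPath-by : ∀ N {a b K} → distance K ≡ N → JoinWith a b K → a ≢ b → SymDiffPath a b K
  symDiffPath-by N {a} {b} {K} dist≡N jK a≢b with differing-edge {F = F} {K} F-IsJoinOf jK a≢b
  ... | e , c , jac , Fe≢Ke = continue N dist≡N
    where
    K' = toggle K e
    jK' : JoinWith c b K'
    jK' = IsJoinOf-cong {F = K'} (λ v → xor-swap-endpoint (t v) (δ a v) (δ b v) (δ c v)) (toggle-IsJoinOf {F = K} jac jK)
    continue : ∀ N → distance K ≡ N → SymDiffPath a b K
    continue zero d≡0 = ⊥-elim (ℕP.0≢1+n (trans (sym d≡0) (distance-toggle K e Fe≢Ke)))
    continue (suc N) d≡ with c ≟ b
    ... | yes refl = SymDiffPath-extend jac Fe≢Ke (SymDiffPath-nil {K = K'} (JoinWith-same {b} {K'} jK')) (a≢b ∷ [])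
    ... | no c≢b with symDiffPath-by N (ℕP.suc-injective (trans (sym (distance-toggle K e Fe≢Ke)) d≡)) jK' c≢b
    ...   | Q with a ∈? walkVertices G (SymDiffPath.path Q)
    ...     | yes a∈Q = SymDiffPath-shortcut jac Fe≢Ke Q a∈Q
    ...     | no a∉Q = SymDiffPath-extend jac Fe≢Ke Q (¬Any⇒All¬ _ a∉Q)

  symDiffPath : ∀ {a b K} → JoinWith a b K → a ≢ b → SymDiffPath a b K
  symDiffPath = symDiffPath-by _ refl

  closable-path-weight : ∀ {s t e} (Q : Walk G s t) → IsPath G Q → Joins G e t s → -[1+ 0 ] ≤ weight G F Q
  closable-path-weight {e = e} Q q jts with e ∈ᴱ? walkEdges G Q
  ... | yes e∈Q =
    subst (-[1+ 0 ] ≤_) (sym (weight-single F Q (path-through-closing-edge Q q jts e∈Q))) (edgeWeight≥-1 F e)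
  ... | no e∉Q = +-cancelˡ-≤ (+ 1) (begin
    + 1 + -[1+ 0 ]                ≡⟨⟩
    0ℤ                            ≤⟨ closedWalk-weight-nonneg (cons e jts Q)
                                                               (¬Any⇒All¬ _ e∉Q ∷ path-edges-unique Q q) ⟩
    edgeWeight F e + weight G F Q ≤⟨ ℤP.+-monoˡ-≤ (weight G F Q) (edgeWeight≤1 F e) ⟩
    + 1 + weight G F Q            ∎)
    where open ℤP.≤-Reasoning

module Extremality (G : Graph) (F : Subset (m G)) where
  open Paths G

  LambdaNonneg-sym : ∀ {x y} → LambdaNonneg G F x y → LambdaNonneg G F y x
  LambdaNonneg-sym λxy≥0 k λyx = λxy≥0 k (LambdaIs-sym F λyx)

  LambdaNonneg-refl : ∀ y → LambdaNonneg G F y y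
  LambdaNonneg-refl y k ((P , p , wP≡k) , _) =
    ℤP.≤-reflexive (trans (sym (cong (Data.List.foldr _ 0ℤ) (closedPath-edges P p))) wP≡k)

  LambdaNonneg⇒weight-nonneg : ∀ {x y} → LambdaNonneg G F x y → (P : Walk G x y) → IsPath G P → 0ℤ ≤ weight G F P
  LambdaNonneg⇒weight-nonneg λ≥0 P p = ℤP.≮⇒≥ λ wP<0 →
    ¬¬LambdaIs-≤ F P p λ { (k , λk , k≤wP) → ℤP.<⇒≱ (ℤP.≤-<-trans k≤wP wP<0) (λ≥0 k λk) }

  Extreme-∪⁅⁆ : ∀ {X y} → Extreme G F X → (∀ x → x ∈ X → LambdaNonneg G F x y) →
                Extreme G F (X ∪ ⁅ y ⁆)
  Extreme-∪⁅⁆ {X} {y} extX λxy≥0 a b a∈ b∈ with x∈p∪q⁻ X ⁅ y ⁆ a∈ | x∈p∪q⁻ X ⁅ y ⁆ b∈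
  ... | inj₁ a∈X | inj₁ b∈X = extX a b a∈X b∈X
  ... | inj₁ a∈X | inj₂ b∈y rewrite x∈⁅y⁆⇒x≡y y b∈y = λxy≥0 a a∈X
  ... | inj₂ a∈y | inj₁ b∈X rewrite x∈⁅y⁆⇒x≡y y a∈y = LambdaNonneg-sym (λxy≥0 b b∈X)
  ... | inj₂ a∈y | inj₂ b∈y rewrite x∈⁅y⁆⇒x≡y y a∈y | x∈⁅y⁆⇒x≡y y b∈y = LambdaNonneg-refl y

module Bipartite (H : BipartiteGraph) where
  open Toggling (graph H) using (edgeWeight)

  Joins⇒colour≢ : ∀ {e a c} → Joins (graph H) e a c → colour H a ≢ colour H c
  Joins⇒colour≢ {e} (inj₁ refl) = proper H e
  Joins⇒colour≢ {e} (inj₂ refl) = proper H e ∘ sym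

  Joins⇒≢ : ∀ {e a c} → Joins (graph H) e a c → a ≢ c
  Joins⇒≢ j refl = Joins⇒colour≢ j refl

  Joins⇒colour-not : ∀ {e a c} → Joins (graph H) e a c → colour H c ≡ not (colour H a)
  Joins⇒colour-not j = ¬-not (Joins⇒colour≢ j ∘ sym)

  isOddℤ : ℤ → Bool
  isOddℤ (+ k) = isOdd k
  isOddℤ -[1+ k ] = not (isOdd k)

  isOddℤ-±1 : ∀ b w → isOddℤ ((if b then -[1+ 0 ] else + 1) + w) ≡ not (isOddℤ w)
  isOddℤ-±1 false (+ k) = refl
  isOddℤ-±1 false -[1+ zero ] = refl
  isOddℤ-±1 false -[1+ suc k ] = sym (not-involutive (not (isOdd k)))
  isOddℤ-±1 true (+ zero) = refl
  isOddℤ-±1 true (+ suc k) = sym (not-involutive (isOdd k))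
  isOddℤ-±1 true -[1+ k ] = refl

  -- every edge changes colour, so the weight of a walk has the parity of its length
  isOddℤ-weight : ∀ F {a b} (w : Walk (graph H) a b) → isOddℤ (weight (graph H) F w) ≡ colour H a xor colour H b
  isOddℤ-weight F {a} nil = sym (xor-same (colour H a))
  isOddℤ-weight F {a} {b} (cons {z = z} e j w) = begin
    isOddℤ (edgeWeight F e + weight (graph H) F w)   ≡⟨ isOddℤ-±1 (lookup F e) _ ⟩
    not (isOddℤ (weight (graph H) F w))              ≡⟨ cong not (isOddℤ-weight F w) ⟩
    not (colour H z xor colour H b)                  ≡⟨ not-distribˡ-xor (colour H z) (colour H b) ⟩
    not (colour H z) xor colour H b                  ≡⟨ cong (λ c → not c xor colour H b) (Joins⇒colour-not j) ⟩
    not (not (colour H a)) xor colour H b            ≡⟨ cong (_xor colour H b) (not-involutive (colour H a)) ⟩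
    colour H a xor colour H b                        ∎
    where open ≡-Reasoning

  even-negative : ∀ k → isOddℤ k ≡ false → k < 0ℤ → k ≤ -[1+ 1 ]
  even-negative -[1+ zero ] () _
  even-negative -[1+ suc k ] _ _ = ℤ.-≤- (ℕ.s≤s ℕ.z≤n)
  even-negative (+ k) _ (ℤ.+<+ ())

module MaximalBipartiticExtremeSet
  (H : BipartiteGraph) {T : Subset (n (graph H))} {F : Subset (m (graph H))} (minF : IsMinJoin (graph H) T F)
  {X : Subset (n (graph H))} (X⊆A : ∀ v → v ∈ X → InA H v) (maxX : MaxBipartiticExtreme H F X) where

  private
    G = graph H

  open Toggling G
  open Paths G
  open Incidence G
  open MinimumJoin G {T} {F} minF
  open Extremality G F
  open Bipartite H
  open import Data.List.Membership.DecPropositional (_≟_ {n G}) using (_∈?_)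
  open import Data.Fin.Subset.Properties using () renaming (_∈?_ to _∈ˢ?_)

  extX : Extreme G F X
  extX = proj₁ (proj₂ maxX)

  InC⇒LambdaNonneg : ∀ {x y} → x ∈ X → InC G F X y → LambdaNonneg G F x y
  InC⇒LambdaNonneg {x} x∈X (y∉X , y∉D) k λk with 0ℤ ℤ.≤? k
  ... | yes 0≤k = 0≤k
  ... | no 0≰k = ⊥-elim (y∉D (y∉X , x , x∈X , k , λk , ℤP.≰⇒> 0≰k))

  InC-path-to-X-nonneg : ∀ {v x} → InC G F X v → x ∈ X → (P : Walk G v x) → IsPath G P → 0ℤ ≤ weight G F P
  InC-path-to-X-nonneg cv x∈X = LambdaNonneg⇒weight-nonneg (LambdaNonneg-sym (InC⇒LambdaNonneg x∈X cv))

  InC⇒InB : ∀ {y} → InC G F X y → InB H y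
  InC⇒InB {y} cy with colour H y in y-colour
  ... | true = refl
  ... | false = ⊥-elim (proj₁ cy (maximal (X ∪ ⁅ y ⁆) bipartitic extreme (p⊆p∪q _) (q⊆p∪q X _ (x∈⁅x⁆ y))))
    where
    maximal = proj₂ (proj₂ maxX)
    bipartitic : Bipartitic H (X ∪ ⁅ y ⁆)
    bipartitic = inj₁ λ v v∈ →
      [ X⊆A v , (λ v∈y → trans (cong (colour H) (x∈⁅y⁆⇒x≡y y v∈y)) y-colour) ]′ (x∈p∪q⁻ X _ v∈)
    extreme : Extreme G F (X ∪ ⁅ y ⁆)
    extreme = Extreme-∪⁅⁆ extX (λ x x∈X → InC⇒LambdaNonneg x∈X cy)

  InC-neighbour-path-weight : ∀ {v e u x} → InC G F X v → x ∈ X → Joins G e v u →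
                              (P : Walk G u x) → IsPath G P → -[1+ 0 ] ≤ weight G F P
  InC-neighbour-path-weight {v} {e} cv x∈X jvu P p = ℤP.≮⇒≥ (not-light ∘ ℤP.i<j⇒i≤pred[j])
    where
    not-light : weight G F P ≤ -[1+ 1 ] → ⊥
    not-light wP≤-2 with v ∈? walkVertices G P
    ... | no v∉P = ℤP.<⇒≱ (ℤP.≤-<-trans (ℤP.+-mono-≤ (edgeWeight≤1 F e) wP≤-2) ℤ.-<+)
                     (InC-path-to-X-nonneg cv x∈X (cons e jvu P) (¬Any⇒All¬ _ v∉P ∷ p))
    ... | yes v∈P = ℤP.<⇒≱ after<0 (InC-path-to-X-nonneg cv x∈X S.after S.after-IsPath)
      where
      open ℤP.≤-Reasoning
      module S = Split (split F P p v∈P)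
      after<0 : weight G F S.after < 0ℤ
      after<0 = ℤP.≤-<-trans (+-cancelˡ-≤ -[1+ 0 ] (begin
        -[1+ 0 ] + weight G F S.after        ≤⟨ ℤP.+-monoˡ-≤ _ (closable-path-weight S.before S.before-IsPath jvu) ⟩
        weight G F S.before + weight G F S.after ≡⟨ sym S.weight-split ⟩
        weight G F P                         ≤⟨ wP≤-2 ⟩
        -[1+ 0 ] + -[1+ 0 ]                  ∎)) ℤ.-<+

  no-edge-D-C : ∀ {e u v} → Joins G e u v → InD G F X u → InC G F X v → ⊥
  no-edge-D-C {e} {u} {v} juv (_ , x , x∈X , k , λxu , k<0) cv with LambdaIs-sym F λxu
  ... | (P , p , wP≡k) , _ = -1≰-2 (ℤP.≤-trans (InC-neighbour-path-weight cv x∈X (Joins-sym juv) P p) wP≤-2)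
    where
    -1≰-2 : ¬ -[1+ 0 ] ≤ -[1+ 1 ]
    -1≰-2 (ℤ.-≤- ())
    u-colour : colour H u ≡ false
    u-colour = trans (Joins⇒colour-not (Joins-sym juv)) (cong not (InC⇒InB cv))
    wP≤-2 : weight G F P ≤ -[1+ 1 ]
    wP≤-2 = even-negative (weight G F P) (trans (isOddℤ-weight F P) (cong₂ _xor_ u-colour (X⊆A x x∈X)))
                          (subst (_< 0ℤ) (sym wP≡k) k<0)

  InC-neighbour∈X : ∀ {v e u} → InC G F X v → Joins G e v u → u ∈ X
  InC-neighbour∈X {v} {e} {u} cv jvu with u ∈ˢ? X
  ... | yes u∈X = u∈X
  ... | no u∉X = ⊥-elim (¬¬-excluded-middle λ where
          (yes du) → no-edge-D-C (Joins-sym jvu) du cv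
          (no u∉D) → Joins⇒colour≢ jvu (trans (InC⇒InB cv) (sym (InC⇒InB (u∉X , u∉D)))))

  InC⇒∉T : ∀ {v} → InC G F X v → lookup T v ≡ false
  InC⇒∉T {v} cv with lookup T v in v∈?T
  ... | false = refl
  ... | true with odd-degree-edge F v (trans (F-IsJoinOf v) v∈?T)
  ...   | e , u , e∈F , jvu =
    ⊥-elim (ℤP.<⇒≱ negative (InC-path-to-X-nonneg cv (InC-neighbour∈X cv jvu) (cons e jvu nil)
                                                   ((Joins⇒≢ jvu ∷ []) ∷ [] ∷ [])))
    where
    negative : edgeWeight F e + 0ℤ < 0ℤ
    negative = subst (_< 0ℤ) (cong (λ b → (if b then -[1+ 0 ] else + 1) + 0ℤ) (sym e∈F)) ℤ.-<+

  module _ {v e u e' u' F'} (minF' : IsMinJoin G T F') (e∈F' : lookup F' e ≡ true) (jvu : Joins G e v u)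
           (e'∈ : lookup (toggle F' e) e' ≡ true) (jvu' : Joins G e' v u') where

    private
      K = toggle (toggle F' e) e'

      K-JoinWith : JoinWith u' u K
      K-JoinWith = IsJoinOf-cong {F = K} (λ w → xor-swap-endpoint (t w) (δ v w) (δ u w) (δ u' w))
        (toggle-IsJoinOf {F = toggle F' e} jvu' (toggle-IsJoinOf {F = F'} jvu (IsJoin⇒IsJoinOf {T} {F'} (proj₁ minF'))))

      K-size : + size G K ≤ + size G F + -[1+ 1 ]
      K-size = begin
        + size G K                                  ≡⟨ size-toggle-∈ {toggle F' e} {e'} e'∈ ⟩
        + size G (toggle F' e) + -[1+ 0 ]           ≡⟨ cong (_+ -[1+ 0 ]) (size-toggle-∈ {F'} {e} e∈F') ⟩
        (+ size G F' + -[1+ 0 ]) + -[1+ 0 ]         ≡⟨ ℤP.+-assoc (+ size G F') -[1+ 0 ] -[1+ 0 ] ⟩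
        + size G F' + -[1+ 1 ]                      ≤⟨ ℤP.+-monoˡ-≤ -[1+ 1 ] (ℤ.+≤+ (proj₂ minF' F (proj₁ minF))) ⟩
        + size G F + -[1+ 1 ]                       ∎
        where open ℤP.≤-Reasoning

      below-K⇒negative : ∀ w → w + + size G F ≤ + size G K → w < 0ℤ
      below-K⇒negative w bound = ℤP.≤-<-trans (+-cancelˡ-≤ (+ size G F) w≤-2) ℤ.-<+
        where
        w≤-2 : + size G F + w ≤ + size G F + -[1+ 1 ]
        w≤-2 = subst (_≤ + size G F + -[1+ 1 ]) (ℤP.+-comm w (+ size G F)) (ℤP.≤-trans bound K-size)

    two-toggles-contradiction : u' ∈ X → u ∈ X → ⊥
    two-toggles-contradiction u'∈X u∈X with u' ≟ u
    ... | yes refl = ℤP.<-irrefl refl (below-K⇒negative 0ℤ (ℤP.≤-trans (ℤP.≤-reflexive (ℤP.+-identityˡ _))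
                                                              (ℤ.+≤+ (size-minimal {K} (JoinWith-same {u} {K} K-JoinWith)))))
    ... | no u'≢u = ℤP.<⇒≱ (below-K⇒negative (weight G F path) bound)
                           (LambdaNonneg⇒weight-nonneg (extX u' u u'∈X u∈X) path isPath)
      where open SymDiffPath (symDiffPath {K = K} K-JoinWith u'≢u)

  InC-no-allowed-edge : ∀ {v e u} → InC G F X v → Allowed G T e → Joins G e v u → ⊥
  InC-no-allowed-edge {v} {e} {u} cv (F' , minF' , e∈F') jvu with odd-degree-edge (toggle F' e) v v-odd
    where
    v-odd : isOdd (degIn G (toggle F' e) v) ≡ true
    v-odd = trans (toggle-IsJoinOf {F = F'} jvu (IsJoin⇒IsJoinOf {T} {F'} (proj₁ minF')) v)
                  (trans (cong₂ (λ a b → a xor (b xor δ u v)) (InC⇒∉T cv) (δ-refl v))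
                         (cong not (δ-≢ (Joins⇒≢ jvu ∘ sym))))
  ... | e' , u' , e'∈ , jvu' = two-toggles-contradiction {F' = F'} minF' ([]=⇒lookup e∈F') jvu e'∈ jvu'
                                 (InC-neighbour∈X cv jvu') (InC-neighbour∈X cv jvu)

  InC⇒Trivial : ∀ {v} → InC G F X v → Trivial G T v
  InC⇒Trivial cv u nil = refl
  InC⇒Trivial cv u (cons e allowed jvu _) = ⊥-elim (InC-no-allowed-edge cv allowed jvu)

lemma6p2 : (H : BipartiteGraph) (T : Subset (n (graph H))) (F : Subset (m (graph H)))
    → IsMinJoin (graph H) T F
    → (X : Subset (n (graph H)))
    → (∀ v → v ∈ X → InA H v)
    → MaxBipartiticExtreme H F X
    → (∀ e → ¬ (InD (graph H) F X (proj₁ (ends (graph H) e)) × InC (graph H) F X (proj₂ (ends (graph H) e)))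
             × ¬ (InC (graph H) F X (proj₁ (ends (graph H) e)) × InD (graph H) F X (proj₂ (ends (graph H) e))))
      × (∀ v → InC (graph H) F X v → Trivial (graph H) T v × InB H v)
lemma6p2 H T F minF X X⊆A maxX =
  (λ e → (λ (du , cv) → no-edge-D-C (inj₁ refl) du cv) , (λ (cu , dv) → no-edge-D-C (inj₂ refl) dv cu)) ,
  (λ v cv → InC⇒Trivial cv , InC⇒InB cv)
  where open MaximalBipartiticExtremeSet H {T} {F} minF {X} X⊆A maxX
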